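{- Let $D$ be a finite digraph that is specular and strongly quadrangular. Then $D$ is the digraph of a unitary matrix.
   Context: Throughout, digraphs are finite, may have loops, and are assumed to have no sources (vertices with no ingoing arcs), no sinks (vertices with no outgoing arcs) and no isolated loopless vertices. For $v\in V(D)$, $N^{+}[v]=\{w:(v,w)\in A(D)\}$ and $N^{ - }[v]=\{u:(u,v)\in A(D)\}$. $D$ is the digraph of an $n\times n$ matrix $M$ (with $V(D)=\{v_1,\dots,v_n\}$) if $(v_i,v_j)\in A(D)$ exactly when $M_{ij}\neq 0$. $D$ is specular if for any two distinct vertices $v,w$: $N^{+}[v]\cap N^{+}[w]\neq\emptyset$ implies $N^{+}[v]=N^{+}[w]$, and $N^{ - }[v]\cap N^{ - }[w]\neq\emptyset$ implies $N^{ - }[v]=N^{ - }[w]$. $D$ is strongly quadrangular if there is no set $S\subseteq V(D)$ such that (a) for every $v\in S$, $N^{+}[v]\cap\bigcup_{w\in S,\,w\neq v}N^{+}[w]\neq\emptyset$, and (b) there is $T\subseteq V(D)$ with $|T|<|S|$ such that $N^{+}[v]\cap N^{+}[w]\subseteq T$ for all distinct $v,w\in S$; and likewise no such $S$ exists with $N^{+}$ replaced by $N^{ - }$ throughout. -}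

module Defs where

open import Data.Nat using (ℕ; zero; suc) renaming (_≤_ to _≤ℕ_; _<_ to _<ℕ_)
open import Data.Fin using (Fin) renaming (zero to fz; suc to fs)
open import Data.Fin.Subset using (Subset; _∈_) renaming (∣_∣ to #_)
open import Data.Bool using (Bool; true; false)
open import Data.Rational using (ℚ; 0ℚ; 1ℚ; _+_; _*_; _-_; -_; ∣_∣; _≤_; _<_)
open import Data.Product using (Σ; ∃; ∃-syntax; _×_; _,_)
open import Relation.Binary.PropositionalEquality using (_≡_; _≢_)
open import Relation.Nullary using (¬_)
open import Data.Empty using (⊥)

Digraph : ℕ → Set
Digraph n = Fin n → Fin n → Bool

Arc : ∀ {n} → Digraph n → Fin n → Fin n → Set
Arc A v w = A v w ≡ true

transpose : ∀ {n} → Digraph n → Digraph n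
transpose A v w = A w v

NoSources : ∀ {n} → Digraph n → Set
NoSources {n} A = ∀ (v : Fin n) → ∃[ u ] Arc A u v

NoSinks : ∀ {n} → Digraph n → Set
NoSinks {n} A = ∀ (v : Fin n) → ∃[ w ] Arc A v w

NoIsolatedLoopless : ∀ {n} → Digraph n → Set
NoIsolatedLoopless {n} A =
  ∀ (v : Fin n) → ¬ ((∀ (w : Fin n) → ¬ Arc A v w × ¬ Arc A w v) × ¬ Arc A v v)

OutMeet : ∀ {n} → Digraph n → Fin n → Fin n → Set
OutMeet A v w = ∃[ x ] (Arc A v x × Arc A w x)

OutEq : ∀ {n} → Digraph n → Fin n → Fin n → Set
OutEq {n} A v w = ∀ (x : Fin n) → A v x ≡ A w x

OutSpecular : ∀ {n} → Digraph n → Set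
OutSpecular {n} A = ∀ (v w : Fin n) → v ≢ w → OutMeet A v w → OutEq A v w

Specular : ∀ {n} → Digraph n → Set
Specular A = OutSpecular A × OutSpecular (transpose A)

OutBad : ∀ {n} → Digraph n → Subset n → Set
OutBad {n} A S =
  (∀ (v : Fin n) → v ∈ S → ∃[ w ] (w ∈ S × w ≢ v × OutMeet A v w))
  × (∃[ T ] ((# T <ℕ # S) ×
       (∀ (v w : Fin n) → v ∈ S → w ∈ S → v ≢ w →
          ∀ (x : Fin n) → Arc A v x → Arc A w x → x ∈ T)))

StronglyQuadrangular : ∀ {n} → Digraph n → Set
StronglyQuadrangular {n} A =
  (∀ (S : Subset n) → ¬ OutBad A S) × (∀ (S : Subset n) → ¬ OutBad (transpose A) S)

-- Complex numbers as (classical) Cauchy sequences of pairs of rationals. Arithmetic is pointwise on sequences; the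
-- relevant equalities are equalities of limits.

Seq : Set
Seq = ℕ → ℚ

Pos : ℚ → Set
Pos ε = 0ℚ < ε

IsCauchy : Seq → Set
IsCauchy x = ∀ (ε : ℚ) → Pos ε →
  ∃[ N ] (∀ (m k : ℕ) → N ≤ℕ m → N ≤ℕ k → ∣ x m - x k ∣ ≤ ε)

_≃_ : Seq → Seq → Set
x ≃ y = ∀ (ε : ℚ) → Pos ε →
  ∃[ N ] (∀ (m : ℕ) → N ≤ℕ m → ∣ x m - y m ∣ ≤ ε)

record CSeq : Set where
  constructor _+i_
  field
    re : Seq
    im : Seq
open CSeq public

IsComplex : CSeq → Set
IsComplex z = IsCauchy (re z) × IsCauchy (im z)

_≈ᶜ_ : CSeq → CSeq → Set
z ≈ᶜ w = (re z ≃ re w) × (im z ≃ im w)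

0ᶜ : CSeq
0ᶜ = (λ _ → 0ℚ) +i (λ _ → 0ℚ)

1ᶜ : CSeq
1ᶜ = (λ _ → 1ℚ) +i (λ _ → 0ℚ)

_+ᶜ_ : CSeq → CSeq → CSeq
z +ᶜ w = (λ k → re z k + re w k) +i (λ k → im z k + im w k)

_*ᶜ_ : CSeq → CSeq → CSeq
z *ᶜ w = (λ k → re z k * re w k - im z k * im w k)
      +i (λ k → re z k * im w k + im z k * re w k)

conj : CSeq → CSeq
conj z = re z +i (λ k → - im z k)

Σᶜ : ∀ {n} → (Fin n → CSeq) → CSeq
Σᶜ {zero}  f = 0ᶜ
Σᶜ {suc n} f = f fz +ᶜ Σᶜ (λ i → f (fs i))

δ : ∀ {n} → Fin n → Fin n → CSeq
δ fz     fz     = 1ᶜ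
δ fz     (fs _) = 0ᶜ
δ (fs _) fz     = 0ᶜ
δ (fs i) (fs j) = δ i j

CMatrix : ℕ → Set
CMatrix n = Fin n → Fin n → CSeq

IsComplexMatrix : ∀ {n} → CMatrix n → Set
IsComplexMatrix {n} U = ∀ (i j : Fin n) → IsComplex (U i j)

IsUnitary : ∀ {n} → CMatrix n → Set
IsUnitary {n} U =
  IsComplexMatrix U
  × (∀ (i j : Fin n) → Σᶜ (λ k → U i k *ᶜ conj (U j k)) ≈ᶜ δ i j)
  × (∀ (i j : Fin n) → Σᶜ (λ k → conj (U k i) *ᶜ U k j) ≈ᶜ δ i j)

IsDigraphOf : ∀ {n} → Digraph n → CMatrix n → Set
IsDigraphOf {n} A U =
  ∀ (i j : Fin n) → (Arc A i j → ¬ (U i j ≈ᶜ 0ᶜ)) × (¬ (U i j ≈ᶜ 0ᶜ) → Arc A i j)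

-- Specularity makes any two out-neighbourhoods (and any two in-neighbourhoods)
-- equal or disjoint, so the arcs split into complete bipartite blocks R × C, and
-- strong quadrangularity forces |R| = |C|.  Matching every block by rank gives a
-- permutation π with all i → π i arcs.  Then U = P − (1 − √−1) W is unitary, where
-- P is the permutation matrix of π and W i k = 1/|C| on the arcs of the block of i:
-- on a d × d block, P − cJ is unitary iff 2 Re c = d |c|², and c = (1 − √−1)/d.
-- Its support is exactly the arc set since Im U = W.  The columns of U are the
-- rows of the same construction for the transposed digraph and π⁻¹.
module Submission where

open import Defs
open import Algebra.Bundles using (Ring)
open import Data.Bool using (Bool; true; false; if_then_else_)
open import Data.Bool.Properties using (¬-not) renaming (_≟_ to _≟ᵇ_)
open import Data.Empty using (⊥)
open import Data.Fin using (Fin; zero; suc; punchOut)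
open import Data.Fin.Properties using (any?; punchOut-injective; injective⇒≤) renaming (_≟_ to _≟ᶠ_)
open import Data.Fin.Subset using (Subset; inside; outside; _∈_; ⁅_⁆; _⊆_) renaming (∣_∣ to #_)
open import Data.Fin.Subset.Properties using (_∈?_; p⊆q⇒∣p∣≤∣q∣; ∣⁅x⁆∣≡1; x∈⁅x⁆; x∈p⇒∣p-x∣<∣p∣)
open import Data.Nat using (ℕ; z≤n; s≤s) renaming (_≤_ to _≤ℕ_; _<_ to _<ℕ_)
import Data.Nat.Properties as ℕ
open import Data.Product using (∃-syntax; _×_; _,_; proj₁; proj₂)
open import Data.Rational
  using (ℚ; 0ℚ; 1ℚ; _+_; _*_; _-_; ∣_∣; ½; 1/_; NonZero; Positive; NonNegative; ≢-nonZero; +-0-rawMonoid)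
  renaming (_≤_ to _≤ℚ_; _<_ to _<ℚ_)
import Data.Rational.Properties as ℚ
open import Data.Rational.Solver using (module +-*-Solver)
open import Data.Vec using (_∷_; tabulate; here; there)
open import Data.Vec.Properties using (lookup∘tabulate; []=⇒lookup; lookup⇒[]=; tabulate-cong)
open import Function using (_∘_; id; flip; Injective)
open import Relation.Binary.PropositionalEquality
open import Relation.Nullary using (¬_; Dec; does; yes; no)
open import Relation.Nullary.Decidable using (_×-dec_; ¬?; dec-true; dec-false; toWitness; decidable-stable)
open import Relation.Nullary.Negation using (contradiction)

open import Algebra.Properties.Semiring.Sum (Ring.semiring ℚ.+-*-ring)
  using (sum-syntax; sum-cong-≗; ∑-distrib-+; *-distribˡ-sum; sum-replicate-zero)
open import Algebra.Definitions.RawMonoid +-0-rawMonoid using () renaming (_×_ to _·_)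
open import Algebra.Properties.Group ℚ.+-0-group using (x∙y⁻¹≈ε⇒x≈y)
open +-*-Solver using (solve; _:=_; _:+_; _:*_; :-_; _:-_; con)

private variable
  n : ℕ

N⁺ : Digraph n → Fin n → Subset n
N⁺ A v = tabulate (A v)

N⁻ : Digraph n → Fin n → Subset n
N⁻ A = N⁺ (transpose A)

module _ (A : Digraph n) {v x : Fin n} where

  arc⇒∈N⁺ : Arc A v x → x ∈ N⁺ A v
  arc⇒∈N⁺ v→x = lookup⇒[]= x (N⁺ A v) (trans (lookup∘tabulate (A v) x) v→x)

  ∈N⁺⇒arc : x ∈ N⁺ A v → Arc A v x
  ∈N⁺⇒arc x∈N⁺v = trans (sym (lookup∘tabulate (A v) x)) ([]=⇒lookup x∈N⁺v)

rank : Subset n → Fin n → ℕ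
rank (s ∷ p) zero    = 0
rank (s ∷ p) (suc x) = (if s then ℕ.suc else id) (rank p x)

rank<∣p∣ : ∀ {p : Subset n} {x} → x ∈ p → rank p x <ℕ # p
rank<∣p∣                   here        = s≤s z≤n
rank<∣p∣ {p = inside  ∷ p} (there x∈p) = s≤s (rank<∣p∣ x∈p)
rank<∣p∣ {p = outside ∷ p} (there x∈p) = rank<∣p∣ x∈p

rank-injective : ∀ {p : Subset n} {x y} → x ∈ p → y ∈ p → rank p x ≡ rank p y → x ≡ y
rank-injective here        here        _  = refl
rank-injective here        (there _)   ()
rank-injective (there _)   here        ()
rank-injective {p = inside  ∷ p} (there x∈p) (there y∈p) eq =
  cong suc (rank-injective x∈p y∈p (ℕ.suc-injective eq))
rank-injective {p = outside ∷ p} (there x∈p) (there y∈p) eq =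
  cong suc (rank-injective x∈p y∈p eq)

rank-surjective : ∀ (p : Subset n) {r} → r <ℕ # p → ∃[ x ] (x ∈ p × rank p x ≡ r)
rank-surjective (inside ∷ p) {ℕ.zero} _ = zero , here , refl
rank-surjective (inside ∷ p) {ℕ.suc r} (s≤s r<∣p∣)
  with x , x∈p , refl ← rank-surjective p r<∣p∣ = suc x , there x∈p , refl
rank-surjective (outside ∷ p) r<∣p∣
  with x , x∈p , refl ← rank-surjective p r<∣p∣ = suc x , there x∈p , refl

x∈p⇒1≤∣p∣ : ∀ {p : Subset n} {x} → x ∈ p → 1 ≤ℕ # p
x∈p⇒1≤∣p∣ x∈p = ℕ.<-≤-trans (s≤s z≤n) (x∈p⇒∣p-x∣<∣p∣ x∈p)

1<∣p∣⇒other-member : ∀ {p : Subset n} x → 1 <ℕ # p → ∃[ y ] (y ∈ p × y ≢ x)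
1<∣p∣⇒other-member {p = p} x 1<∣p∣ with any? (λ y → (y ∈? p) ×-dec ¬? (y ≟ᶠ x))
... | yes found = found
... | no none   =
  contradiction (subst (# p ≤ℕ_) (∣⁅x⁆∣≡1 x) (p⊆q⇒∣p∣≤∣q∣ p⊆⁅x⁆)) (ℕ.<⇒≱ 1<∣p∣)
  where
  p⊆⁅x⁆ : p ⊆ ⁅ x ⁆
  p⊆⁅x⁆ {y} y∈p with y ≟ᶠ x
  ... | yes refl = x∈⁅x⁆ x
  ... | no  y≢x  = contradiction (y , y∈p , y≢x) none

injective⇒surjective : ∀ {f : Fin n → Fin n} → Injective _≡_ _≡_ f → ∀ y → ∃[ x ] f x ≡ y
injective⇒surjective {ℕ.suc n} {f} f-injective y with any? (λ x → f x ≟ᶠ y)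
... | yes hit  = hit
... | no  miss = contradiction (injective⇒≤ punched-injective) ℕ.1+n≰n
  where
  y≢f : ∀ x → y ≢ f x
  y≢f x y≡fx = miss (x , sym y≡fx)
  punched : Fin (ℕ.suc n) → Fin n
  punched x = punchOut (y≢f x)
  punched-injective : Injective _≡_ _≡_ punched
  punched-injective {x} {x′} = f-injective ∘ punchOut-injective (y≢f x) (y≢f x′)

module _ {A : Digraph n} (specular : OutSpecular A) where

  meet⇒eq : ∀ {v w} → OutMeet A v w → OutEq A v w
  meet⇒eq {v} {w} meet with v ≟ᶠ w
  ... | yes refl = λ _ → refl
  ... | no  v≢w  = specular v w v≢w meet

  meet⇒N⁺≡ : ∀ {v w} → OutMeet A v w → N⁺ A v ≡ N⁺ A w
  meet⇒N⁺≡ meet = tabulate-cong (meet⇒eq meet)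

  -- Otherwise N⁻(x) is a bad set with T = N⁺(i): its members share the
  -- out-neighbour x with i, so by specularity they all have out-neighbourhood N⁺(i).
  in-degree≤out-degree : (∀ S → ¬ OutBad A S) → ∀ {i x} → Arc A i x → # N⁻ A x ≤ℕ # N⁺ A i
  in-degree≤out-degree quadrangular {i} {x} i→x with # N⁻ A x ℕ.≤? # N⁺ A i
  ... | yes in≤out = in≤out
  ... | no  in≰out =
    contradiction (meets-another , N⁺ A i , ℕ.≰⇒> in≰out , meets⊆N⁺i) (quadrangular (N⁻ A x))
    where
    1<in : 1 <ℕ # N⁻ A x
    1<in = ℕ.<-≤-trans (s≤s (x∈p⇒1≤∣p∣ (arc⇒∈N⁺ A i→x))) (ℕ.≰⇒> in≰out)
    meets-another : ∀ v → v ∈ N⁻ A x → ∃[ w ] (w ∈ N⁻ A x × w ≢ v × OutMeet A v w)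
    meets-another v v∈N⁻x with w , w∈N⁻x , w≢v ← 1<∣p∣⇒other-member v 1<in =
      w , w∈N⁻x , w≢v , x , ∈N⁺⇒arc (transpose A) v∈N⁻x , ∈N⁺⇒arc (transpose A) w∈N⁻x
    meets⊆N⁺i : ∀ v w → v ∈ N⁻ A x → w ∈ N⁻ A x → v ≢ w →
                ∀ y → Arc A v y → Arc A w y → y ∈ N⁺ A i
    meets⊆N⁺i v _ v∈N⁻x _ _ y v→y _ =
      subst (y ∈_) (meet⇒N⁺≡ (x , ∈N⁺⇒arc (transpose A) v∈N⁻x , i→x)) (arc⇒∈N⁺ A v→y)

module _ {A : Digraph n} (specular : Specular A) (quadrangular : StronglyQuadrangular A) where

  degree-balanced : ∀ {i x} → Arc A i x → # N⁺ A i ≡ # N⁻ A x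
  degree-balanced i→x = ℕ.≤-antisym
    (in-degree≤out-degree (proj₂ specular) (proj₂ quadrangular) i→x)
    (in-degree≤out-degree (proj₁ specular) (proj₁ quadrangular) i→x)

  -- π(i) is the out-neighbour of i whose rank in N⁺(i) is the rank of i in
  -- N⁻(w), for a fixed out-neighbour w of i; this set N⁻(w) does not depend
  -- on the choice of w.
  perfect-matching : NoSinks A → ∃[ π ] (Injective _≡_ _≡_ π × ∀ i → Arc A i (π i))
  perfect-matching no-sinks = π , π-injective , π-arc
    where
    w : Fin n → Fin n
    w i = proj₁ (no-sinks i)
    i→w : ∀ i → Arc A i (w i)
    i→w i = proj₂ (no-sinks i)
    i∈N⁻w : ∀ i → i ∈ N⁻ A (w i)
    i∈N⁻w i = arc⇒∈N⁺ (transpose A) (i→w i)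
    matched : ∀ i → ∃[ y ] (y ∈ N⁺ A i × rank (N⁺ A i) y ≡ rank (N⁻ A (w i)) i)
    matched i = rank-surjective (N⁺ A i)
      (ℕ.<-≤-trans (rank<∣p∣ (i∈N⁻w i)) (ℕ.≤-reflexive (sym (degree-balanced (i→w i)))))
    π : Fin n → Fin n
    π i = proj₁ (matched i)
    π-arc : ∀ i → Arc A i (π i)
    π-arc i = ∈N⁺⇒arc A (proj₁ (proj₂ (matched i)))
    π-injective : Injective _≡_ _≡_ π
    π-injective {i} {j} πi≡πj = rank-injective (i∈N⁻w i) j∈N⁻wi ranks≡
      where
      N⁺i≡N⁺j : N⁺ A i ≡ N⁺ A j
      N⁺i≡N⁺j = meet⇒N⁺≡ (proj₁ specular)
        (π i , π-arc i , subst (Arc A j) (sym πi≡πj) (π-arc j))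
      N⁻wj≡N⁻wi : N⁻ A (w j) ≡ N⁻ A (w i)
      N⁻wj≡N⁻wi = meet⇒N⁺≡ (proj₂ specular)
        (j , i→w j , ∈N⁺⇒arc A (subst (w i ∈_) N⁺i≡N⁺j (arc⇒∈N⁺ A (i→w i))))
      j∈N⁻wi : j ∈ N⁻ A (w i)
      j∈N⁻wi = subst (j ∈_) N⁻wj≡N⁻wi (i∈N⁻w j)
      ranks≡ : rank (N⁻ A (w i)) i ≡ rank (N⁻ A (w i)) j
      ranks≡ = begin
        rank (N⁻ A (w i)) i  ≡⟨ sym (proj₂ (proj₂ (matched i))) ⟩
        rank (N⁺ A i) (π i)  ≡⟨ cong₂ rank N⁺i≡N⁺j πi≡πj ⟩
        rank (N⁺ A j) (π j)  ≡⟨ proj₂ (proj₂ (matched j)) ⟩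
        rank (N⁻ A (w j)) j  ≡⟨ cong (λ p → rank p j) N⁻wj≡N⁻wi ⟩
        rank (N⁻ A (w i)) j  ∎
        where open ≡-Reasoning

⟦_⟧ : Bool → ℚ
⟦ true ⟧  = 1ℚ
⟦ false ⟧ = 0ℚ

∑-zero : ∀ {f : Fin n → ℚ} → (∀ k → f k ≡ 0ℚ) → ∑[ k < n ] f k ≡ 0ℚ
∑-zero {n} f≗0 = trans (sum-cong-≗ f≗0) (sum-replicate-zero n)

∑-distrib-- : ∀ (f g : Fin n → ℚ) → ∑[ k < n ] (f k - g k) ≡ ∑[ k < n ] f k - ∑[ k < n ] g k
∑-distrib-- {ℕ.zero}  f g = refl
∑-distrib-- {ℕ.suc n} f g = trans (cong (f zero - g zero +_) (∑-distrib-- (f ∘ suc) (g ∘ suc)))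
  (solve 4 (λ a b c d → (a :- b) :+ (c :- d) := (a :+ c) :- (b :+ d)) refl
    (f zero) (g zero) (∑[ k < n ] f (suc k)) (∑[ k < n ] g (suc k)))

∑-sift : ∀ (j : Fin n) (f : Fin n → ℚ) → ∑[ k < n ] (⟦ does (j ≟ᶠ k) ⟧ * f k) ≡ f j
∑-sift zero    f = trans (cong (1ℚ * f zero +_) (∑-zero (λ k → ℚ.*-zeroˡ (f (suc k)))))
  (solve 1 (λ x → con 1ℚ :* x :+ con 0ℚ := x) refl (f zero))
∑-sift (suc j) f = trans (cong (0ℚ * f zero +_) (∑-sift j (f ∘ suc)))
  (solve 2 (λ x y → con 0ℚ :* x :+ y := y) refl (f zero) (f (suc j)))

cardℚ : (Fin n → Bool) → ℚ
cardℚ {n} r = ∑[ k < n ] ⟦ r k ⟧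

cardℚ≡∣tabulate∣ : ∀ (r : Fin n → Bool) → cardℚ r ≡ # tabulate r · 1ℚ
cardℚ≡∣tabulate∣ {ℕ.zero}  r = refl
cardℚ≡∣tabulate∣ {ℕ.suc n} r with r zero
... | true  = cong (1ℚ +_) (cardℚ≡∣tabulate∣ (r ∘ suc))
... | false = trans (ℚ.+-identityˡ _) (cardℚ≡∣tabulate∣ (r ∘ suc))

⟦⟧-nonNeg : ∀ b → NonNegative ⟦ b ⟧
⟦⟧-nonNeg true  = _
⟦⟧-nonNeg false = _

cardℚ-nonNeg : ∀ (r : Fin n → Bool) → NonNegative (cardℚ r)
cardℚ-nonNeg {ℕ.zero}  r = _
cardℚ-nonNeg {ℕ.suc n} r = ℚ.nonNeg+nonNeg⇒nonNeg
  ⟦ r zero ⟧ {{⟦⟧-nonNeg (r zero)}} (cardℚ (r ∘ suc)) {{cardℚ-nonNeg (r ∘ suc)}}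

cardℚ-positive : ∀ (r : Fin n → Bool) {k} → r k ≡ true → Positive (cardℚ r)
cardℚ-positive r {zero} rk rewrite rk =
  ℚ.pos+nonNeg⇒pos 1ℚ (cardℚ (r ∘ suc)) {{cardℚ-nonNeg (r ∘ suc)}}
cardℚ-positive r {suc k} rk = ℚ.nonNeg+pos⇒pos
  ⟦ r zero ⟧ {{⟦⟧-nonNeg (r zero)}} (cardℚ (r ∘ suc)) {{cardℚ-positive (r ∘ suc) rk}}

cardℚ-nonZero : ∀ (r : Fin n → Bool) {k} → r k ≡ true → NonZero (cardℚ r)
cardℚ-nonZero r rk = ℚ.pos⇒nonZero (cardℚ r) {{cardℚ-positive r rk}}

cardℚ⁻¹ : ∀ (r : Fin n → Bool) {k} → r k ≡ true → ℚ
cardℚ⁻¹ r rk = (1/ cardℚ r) {{cardℚ-nonZero r rk}}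

cardℚ⁻¹*cardℚ : ∀ (r : Fin n → Bool) {k} (rk : r k ≡ true) → cardℚ⁻¹ r rk * cardℚ r ≡ 1ℚ
cardℚ⁻¹*cardℚ r rk = ℚ.*-inverseˡ (cardℚ r) {{cardℚ-nonZero r rk}}

cardℚ⁻¹-cong : ∀ {r r′ : Fin n → Bool} {k k′} (rk : r k ≡ true) (r′k′ : r′ k′ ≡ true) →
  cardℚ r ≡ cardℚ r′ → cardℚ⁻¹ r rk ≡ cardℚ⁻¹ r′ r′k′
cardℚ⁻¹-cong {r = r} {r′} rk r′k′ = 1/-cong {{cardℚ-nonZero r rk}} {{cardℚ-nonZero r′ r′k′}}
  where
  1/-cong : ∀ {p q} .{{_ : NonZero p}} .{{_ : NonZero q}} → p ≡ q → 1/ p ≡ 1/ q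
  1/-cong refl = refl

⟦⟧-scale-cong : ∀ {p q} b → (b ≡ true → p ≡ q) → p * ⟦ b ⟧ ≡ q * ⟦ b ⟧
⟦⟧-scale-cong         true  p≡q = cong (_* 1ℚ) (p≡q refl)
⟦⟧-scale-cong {p} {q} false _   = trans (ℚ.*-zeroʳ p) (sym (ℚ.*-zeroʳ q))

⟦⟧-weighted-square : ∀ x y b → y * (x * ⟦ b ⟧) ≡ x * ⟦ b ⟧ * (y * ⟦ b ⟧)
⟦⟧-weighted-square x y true  =
  solve 2 (λ x y → y :* (x :* con 1ℚ) := x :* con 1ℚ :* (y :* con 1ℚ)) refl x y
⟦⟧-weighted-square x y false =
  solve 2 (λ x y → y :* (x :* con 0ℚ) := x :* con 0ℚ :* (y :* con 0ℚ)) refl x y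

⟦⟧-weighted-disjoint : ∀ x y {b c} → (b ≡ true → c ≡ true → ⊥) → x * ⟦ b ⟧ * (y * ⟦ c ⟧) ≡ 0ℚ
⟦⟧-weighted-disjoint x y {false} {c}   _     =
  solve 2 (λ x y → x :* con 0ℚ :* y := con 0ℚ) refl x (y * ⟦ c ⟧)
⟦⟧-weighted-disjoint x y {true}  {false} _     =
  solve 2 (λ x y → x :* (y :* con 0ℚ) := con 0ℚ) refl (x * 1ℚ) y
⟦⟧-weighted-disjoint x y {true}  {true}  ¬both = contradiction refl (¬both refl)

does-cong : ∀ {a b} {A : Set a} {B : Set b} →
  (A → B) → (B → A) → (a? : Dec A) (b? : Dec B) → does a? ≡ does b?
does-cong A→B B→A a? (yes b) = dec-true a? (B→A b)
does-cong A→B B→A a? (no ¬b) = dec-false a? (¬b ∘ A→B)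

∣p-p∣≤ε : ∀ p {ε} → Pos ε → ∣ p - p ∣ ≤ℚ ε
∣p-p∣≤ε p ε>0 = subst (λ d → ∣ d ∣ ≤ℚ _) (sym (ℚ.+-inverseʳ p)) (ℚ.<⇒≤ ε>0)

const-cauchy : ∀ q → IsCauchy (λ _ → q)
const-cauchy q ε ε>0 = 0 , λ _ _ _ _ → ∣p-p∣≤ε q ε>0

≗⇒≃ : ∀ {x y : Seq} → (∀ m → x m ≡ y m) → x ≃ y
≗⇒≃ {x} {y} x≗y ε ε>0 =
  0 , λ m _ → subst (λ z → ∣ z - y m ∣ ≤ℚ ε) (sym (x≗y m)) (∣p-p∣≤ε (y m) ε>0)

-- With d = ∣p - q∣ > 0, the tolerance ε = d/2 is never met.
const-≄ : ∀ {p q} → p ≢ q → ¬ ((λ _ → p) ≃ (λ _ → q))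
const-≄ {p} {q} p≢q p≃q = ℚ.<-irrefl refl (ℚ.≤-<-trans d≤½d ½d<d)
  where
  d : ℚ
  d = ∣ p - q ∣
  instance
    d-nonNeg : NonNegative d
    d-nonNeg = ℚ.∣-∣-nonNeg (p - q)
    d-nonZero : NonZero d
    d-nonZero = ≢-nonZero (p≢q ∘ x∙y⁻¹≈ε⇒x≈y p q ∘ ℚ.∣p∣≡0⇒p≡0 (p - q))
    d-pos : Positive d
    d-pos = ℚ.nonNeg∧nonZero⇒pos d
  d≤½d : d ≤ℚ ½ * d
  d≤½d = proj₂ (p≃q (½ * d) (ℚ.positive⁻¹ (½ * d) {{ℚ.pos*pos⇒pos ½ d}})) _ ℕ.≤-refl
  ½d<d : ½ * d <ℚ d
  ½d<d = subst (½ * d <ℚ_) (ℚ.*-identityˡ d) (ℚ.*-monoˡ-<-pos d (toWitness {a? = ½ ℚ.<? 1ℚ} _))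

re-Σᶜ : ∀ (f : Fin n → CSeq) m → re (Σᶜ f) m ≡ ∑[ k < n ] re (f k) m
re-Σᶜ {ℕ.zero}  f m = refl
re-Σᶜ {ℕ.suc n} f m = cong (re (f zero) m +_) (re-Σᶜ (f ∘ suc) m)

im-Σᶜ : ∀ (f : Fin n → CSeq) m → im (Σᶜ f) m ≡ ∑[ k < n ] im (f k) m
im-Σᶜ {ℕ.zero}  f m = refl
im-Σᶜ {ℕ.suc n} f m = cong (im (f zero) m +_) (im-Σᶜ (f ∘ suc) m)

re-δ : ∀ (i j : Fin n) m → re (δ i j) m ≡ ⟦ does (i ≟ᶠ j) ⟧
re-δ zero    zero    m = refl
re-δ zero    (suc j) m = refl
re-δ (suc i) zero    m = refl
re-δ (suc i) (suc j) m = re-δ i j m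

im-δ : ∀ (i j : Fin n) m → im (δ i j) m ≡ 0ℚ
im-δ zero    zero    m = refl
im-δ zero    (suc j) m = refl
im-δ (suc i) zero    m = refl
im-δ (suc i) (suc j) m = im-δ i j m

Σᶜ≈δ : ∀ (f : Fin n → CSeq) (i j : Fin n) →
  (∀ m → ∑[ k < n ] re (f k) m ≡ ⟦ does (i ≟ᶠ j) ⟧) → (∀ m → ∑[ k < n ] im (f k) m ≡ 0ℚ) →
  Σᶜ f ≈ᶜ δ i j
Σᶜ≈δ f i j re≡ im≡ =
    ≗⇒≃ (λ m → trans (re-Σᶜ f m) (trans (re≡ m) (sym (re-δ i j m))))
  , ≗⇒≃ (λ m → trans (im-Σᶜ f m) (trans (im≡ m) (sym (im-δ i j m))))

Matrixℚ : ℕ → Set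
Matrixℚ n = Fin n → Fin n → ℚ

gaussian : Matrixℚ n → Matrixℚ n → CMatrix n
gaussian X Y i j = (λ _ → X i j) +i (λ _ → Y i j)

-- The real and imaginary parts of (U U*) i j = δ i j for U = X + √−1 Y.
RowsOrthonormal : Matrixℚ n → Matrixℚ n → Set
RowsOrthonormal {n} X Y = ∀ i j →
    ∑[ k < n ] (X i k * X j k + Y i k * Y j k) ≡ ⟦ does (i ≟ᶠ j) ⟧
  × ∑[ k < n ] (Y i k * X j k - X i k * Y j k) ≡ 0ℚ

RowsOrthonormal-cong : ∀ {X X′ Y Y′ : Matrixℚ n} → (∀ i k → X i k ≡ X′ i k) → (∀ i k → Y i k ≡ Y′ i k) →
  RowsOrthonormal X Y → RowsOrthonormal X′ Y′
RowsOrthonormal-cong {n} {X} {X′} {Y} {Y′} X≗X′ Y≗Y′ orthonormal i j =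
    trans (sum-cong-≗ re-summands) (proj₁ (orthonormal i j))
  , trans (sum-cong-≗ im-summands) (proj₂ (orthonormal i j))
  where
  product-cong : ∀ {Z Z′ V V′ : Matrixℚ n} → (∀ i k → Z i k ≡ Z′ i k) → (∀ i k → V i k ≡ V′ i k) →
    ∀ k → Z′ i k * V′ j k ≡ Z i k * V j k
  product-cong Z≗Z′ V≗V′ k = sym (cong₂ _*_ (Z≗Z′ i k) (V≗V′ j k))
  re-summands : ∀ k → X′ i k * X′ j k + Y′ i k * Y′ j k ≡ X i k * X j k + Y i k * Y j k
  re-summands k = cong₂ _+_ (product-cong X≗X′ X≗X′ k) (product-cong Y≗Y′ Y≗Y′ k)
  im-summands : ∀ k → Y′ i k * X′ j k - X′ i k * Y′ j k ≡ Y i k * X j k - X i k * Y j k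
  im-summands k = cong₂ _-_ (product-cong Y≗Y′ X≗X′ k) (product-cong X≗X′ Y≗Y′ k)

gaussian-unitary : ∀ {X Y : Matrixℚ n} →
  RowsOrthonormal X Y → RowsOrthonormal (flip X) (flip Y) → IsUnitary (gaussian X Y)
gaussian-unitary {n} {X} {Y} rows columns = complex-entries , row-products , column-products
  where
  U : CMatrix n
  U = gaussian X Y

  complex-entries : IsComplexMatrix U
  complex-entries i j = const-cauchy (X i j) , const-cauchy (Y i j)

  row-products : ∀ i j → Σᶜ (λ k → U i k *ᶜ conj (U j k)) ≈ᶜ δ i j
  row-products i j = Σᶜ≈δ (λ k → U i k *ᶜ conj (U j k)) i j
    (λ _ → trans (sum-cong-≗ (λ k → solve 4 (λ a b c d → a :* b :- c :* (:- d) := a :* b :+ c :* d)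
                                        refl (X i k) (X j k) (Y i k) (Y j k)))
                 (proj₁ (rows i j)))
    (λ _ → trans (sum-cong-≗ (λ k → solve 4 (λ a b c d → a :* (:- d) :+ c :* b := c :* b :- a :* d)
                                        refl (X i k) (X j k) (Y i k) (Y j k)))
                 (proj₂ (rows i j)))

  column-products : ∀ i j → Σᶜ (λ k → conj (U k i) *ᶜ U k j) ≈ᶜ δ i j
  column-products i j = Σᶜ≈δ (λ k → conj (U k i) *ᶜ U k j) i j
    (λ _ → trans (sum-cong-≗ (λ k → solve 4 (λ a b c d → a :* b :- (:- c) :* d := a :* b :+ c :* d)
                                        refl (X k i) (X k j) (Y k i) (Y k j)))
                 (proj₁ (columns i j)))
    (λ _ → trans (sum-cong-≗ (λ k → solve 4 (λ a b c d → a :* d :+ (:- c) :* b := d :* a :- b :* c)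
                                        refl (X k i) (X k j) (Y k i) (Y k j)))
                 (proj₂ (columns j i)))

permutation-matrix : (Fin n → Fin n) → Matrixℚ n
permutation-matrix π i k = ⟦ does (π i ≟ᶠ k) ⟧

-- For U = P − (1 − √−1) W, sifting through P reduces U U* = I to the hypothesis W-gram.
module _ {π : Fin n → Fin n} (π-injective : Injective _≡_ _≡_ π) (W : Matrixℚ n)
         (W-gram : ∀ i j → W j (π i) ≡ ∑[ k < n ] (W i k * W j k)) where

  private
    P : Matrixℚ n
    P = permutation-matrix π

    G : Fin n → Fin n → ℚ
    G i j = ∑[ k < n ] (W i k * W j k)

    sift-P : ∀ i j → ∑[ k < n ] (P j k * P i k) ≡ ⟦ does (i ≟ᶠ j) ⟧
    sift-P i j = trans (∑-sift (π j) (P i))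
      (cong ⟦_⟧ (does-cong π-injective (cong π) (π i ≟ᶠ π j) (i ≟ᶠ j)))

    sift-W : ∀ i j → ∑[ k < n ] (P i k * W j k) ≡ G i j
    sift-W i j = trans (∑-sift (π i) (W j)) (W-gram i j)

    sift-W′ : ∀ i j → ∑[ k < n ] (P j k * W i k) ≡ G i j
    sift-W′ i j = trans (∑-sift (π j) (W i))
      (trans (W-gram j i) (sum-cong-≗ (λ k → ℚ.*-comm (W j k) (W i k))))

  permutation-minus-weights-orthonormal : RowsOrthonormal (λ i k → permutation-matrix π i k - W i k) W
  permutation-minus-weights-orthonormal i j = re-part , im-part
    where
    open ≡-Reasoning
    ∑PP ∑PW ∑WP : ℚ
    ∑PP = ∑[ k < n ] (P j k * P i k)
    ∑PW = ∑[ k < n ] (P i k * W j k)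
    ∑WP = ∑[ k < n ] (P j k * W i k)
    re-part : ∑[ k < n ] ((P i k - W i k) * (P j k - W j k) + W i k * W j k) ≡ ⟦ does (i ≟ᶠ j) ⟧
    re-part = begin
      ∑[ k < n ] ((P i k - W i k) * (P j k - W j k) + W i k * W j k)
        ≡⟨ sum-cong-≗ (λ k → solve 4 (λ pi pj wi wj →
             (pi :- wi) :* (pj :- wj) :+ wi :* wj := pj :* pi :- (pi :* wj :+ pj :* wi) :+ (wi :* wj :+ wi :* wj))
             refl (P i k) (P j k) (W i k) (W j k)) ⟩
      ∑[ k < n ] (P j k * P i k - (P i k * W j k + P j k * W i k) + (W i k * W j k + W i k * W j k))
        ≡⟨ ∑-distrib-+ {n} _ _ ⟩
      ∑[ k < n ] (P j k * P i k - (P i k * W j k + P j k * W i k)) + ∑[ k < n ] (W i k * W j k + W i k * W j k)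
        ≡⟨ cong₂ _+_ (trans (∑-distrib-- {n} _ _) (cong (_-_ ∑PP) (∑-distrib-+ {n} _ _))) (∑-distrib-+ {n} _ _) ⟩
      ∑PP - (∑PW + ∑WP) + (G i j + G i j)
        ≡⟨ cong₂ (λ p w → p - w + (G i j + G i j)) (sift-P i j) (cong₂ _+_ (sift-W i j) (sift-W′ i j)) ⟩
      ⟦ does (i ≟ᶠ j) ⟧ - (G i j + G i j) + (G i j + G i j)
        ≡⟨ solve 2 (λ d g → d :- g :+ g := d) refl ⟦ does (i ≟ᶠ j) ⟧ (G i j + G i j) ⟩
      ⟦ does (i ≟ᶠ j) ⟧ ∎
    im-part : ∑[ k < n ] (W i k * (P j k - W j k) - (P i k - W i k) * W j k) ≡ 0ℚ
    im-part = begin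
      ∑[ k < n ] (W i k * (P j k - W j k) - (P i k - W i k) * W j k)
        ≡⟨ sum-cong-≗ (λ k → solve 4 (λ pi pj wi wj →
             wi :* (pj :- wj) :- (pi :- wi) :* wj := pj :* wi :- pi :* wj)
             refl (P i k) (P j k) (W i k) (W j k)) ⟩
      ∑[ k < n ] (P j k * W i k - P i k * W j k)
        ≡⟨ ∑-distrib-- {n} _ _ ⟩
      ∑WP - ∑PW
        ≡⟨ cong₂ _-_ (sift-W′ i j) (sift-W i j) ⟩
      G i j - G i j
        ≡⟨ ℚ.+-inverseʳ (G i j) ⟩
      0ℚ ∎

module BlockWeights {a : Digraph n} (meet⇒eq : ∀ {i j} → OutMeet a i j → OutEq a i j)
                    {π : Fin n → Fin n} (π-arc : ∀ i → Arc a i (π i))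
                    (s : Fin n → ℚ) (s*cardℚ : ∀ i → s i * cardℚ (a i) ≡ 1ℚ) where

  W : Matrixℚ n
  W i k = s i * ⟦ a i k ⟧

  -- Within a block of out-degree d both sides are 1/d = d · (1/d)²;
  -- across blocks both are 0.
  W-gram : ∀ i j → W j (π i) ≡ ∑[ k < n ] (W i k * W j k)
  W-gram i j with a j (π i) in j→πi
  ... | true = begin
      s j * 1ℚ                              ≡⟨ cong (s j *_) (sym (s*cardℚ i)) ⟩
      s j * (s i * cardℚ (a i))             ≡⟨ cong (s j *_) (*-distribˡ-sum (s i) (λ k → ⟦ a i k ⟧)) ⟩
      s j * ∑[ k < n ] (s i * ⟦ a i k ⟧)    ≡⟨ *-distribˡ-sum (s j) (λ k → s i * ⟦ a i k ⟧) ⟩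
      ∑[ k < n ] (s j * (s i * ⟦ a i k ⟧))  ≡⟨ sum-cong-≗ same-row ⟩
      ∑[ k < n ] (W i k * W j k)            ∎
    where
    open ≡-Reasoning
    same-row : ∀ k → s j * (s i * ⟦ a i k ⟧) ≡ W i k * W j k
    same-row k = trans (⟦⟧-weighted-square (s i) (s j) (a i k))
                       (cong (λ b → W i k * (s j * ⟦ b ⟧)) (meet⇒eq (π i , π-arc i , j→πi) k))
  ... | false = trans (ℚ.*-zeroʳ (s j)) (sym (∑-zero disjoint-rows))
    where
    disjoint-rows : ∀ k → W i k * W j k ≡ 0ℚ
    disjoint-rows k = ⟦⟧-weighted-disjoint (s i) (s j) λ i→k j→k →
      contradiction (trans (sym (π-arc i)) (trans (meet⇒eq (k , i→k , j→k) (π i)) j→πi)) λ ()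

  W-nonzero : ∀ {i k} → Arc a i k → W i k ≢ 0ℚ
  W-nonzero {i} {k} i→k Wik≡0 = ℚ.1≢0 (begin
    1ℚ                  ≡⟨ sym (s*cardℚ i) ⟩
    s i * cardℚ (a i)   ≡⟨ cong (_* cardℚ (a i)) si≡0 ⟩
    0ℚ * cardℚ (a i)    ≡⟨ ℚ.*-zeroˡ (cardℚ (a i)) ⟩
    0ℚ                  ∎)
    where
    open ≡-Reasoning
    si≡0 : s i ≡ 0ℚ
    si≡0 = trans (sym (ℚ.*-identityʳ (s i))) (trans (cong (λ b → s i * ⟦ b ⟧) (sym i→k)) Wik≡0)

  W-zero : ∀ {i k} → ¬ Arc a i k → W i k ≡ 0ℚ
  W-zero {i} i↛k = trans (cong (λ b → s i * ⟦ b ⟧) (¬-not i↛k)) (ℚ.*-zeroʳ (s i))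

module _ {A : Digraph n} (specular : Specular A) (quadrangular : StronglyQuadrangular A)
         (no-sinks : NoSinks A) where

  private
    matching : ∃[ π ] (Injective _≡_ _≡_ π × ∀ i → Arc A i (π i))
    matching = perfect-matching specular quadrangular no-sinks

    π : Fin n → Fin n
    π = proj₁ matching

    π-injective : Injective _≡_ _≡_ π
    π-injective = proj₁ (proj₂ matching)

    π-arc : ∀ i → Arc A i (π i)
    π-arc = proj₂ (proj₂ matching)

    σ : Fin n → Fin n
    σ x = proj₁ (injective⇒surjective π-injective x)

    π∘σ : ∀ x → π (σ x) ≡ x
    π∘σ x = proj₂ (injective⇒surjective π-injective x)

    σ-injective : Injective _≡_ _≡_ σ
    σ-injective {x} {y} σx≡σy = trans (sym (π∘σ x)) (trans (cong π σx≡σy) (π∘σ y))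

    σ-arc : ∀ x → Arc (transpose A) x (σ x)
    σ-arc x = subst (Arc A (σ x)) (π∘σ x) (π-arc (σ x))

    cardℚ-balanced : ∀ {u x} → Arc A u x → cardℚ (A u) ≡ cardℚ (transpose A x)
    cardℚ-balanced {u} {x} u→x = begin
      cardℚ (A u)                 ≡⟨ cardℚ≡∣tabulate∣ (A u) ⟩
      # N⁺ A u · 1ℚ               ≡⟨ cong (_· 1ℚ) (degree-balanced specular quadrangular u→x) ⟩
      # N⁻ A x · 1ℚ               ≡⟨ cardℚ≡∣tabulate∣ (transpose A x) ⟨
      cardℚ (transpose A x)       ∎
      where open ≡-Reasoning

    s : Fin n → ℚ
    s i = cardℚ⁻¹ (A i) (π-arc i)

    t : Fin n → ℚ
    t x = cardℚ⁻¹ (transpose A x) (σ-arc x)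

    module Out = BlockWeights (meet⇒eq (proj₁ specular)) π-arc s
                   (λ i → cardℚ⁻¹*cardℚ (A i) (π-arc i))
    module In  = BlockWeights (meet⇒eq (proj₂ specular)) σ-arc t
                   (λ x → cardℚ⁻¹*cardℚ (transpose A x) (σ-arc x))

    P-transpose : ∀ x u → permutation-matrix σ x u ≡ permutation-matrix π u x
    P-transpose x u = cong ⟦_⟧ (does-cong {A = σ x ≡ u} {B = π u ≡ x}
      (λ σx≡u → trans (cong π (sym σx≡u)) (π∘σ x))
      (λ πu≡x → π-injective (trans (π∘σ x) (sym πu≡x)))
      (σ x ≟ᶠ u) (π u ≟ᶠ x))

    W-transpose : ∀ x u → In.W x u ≡ Out.W u x
    W-transpose x u = ⟦⟧-scale-cong {p = t x} {q = s u} (A u x) λ u→x →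
      cardℚ⁻¹-cong {r = transpose A x} {r′ = A u} (σ-arc x) (π-arc u) (sym (cardℚ-balanced u→x))

    X : Matrixℚ n
    X i k = permutation-matrix π i k - Out.W i k

    U : CMatrix n
    U = gaussian X Out.W

    unitary : IsUnitary U
    unitary = gaussian-unitary {X = X} {Y = Out.W}
      (permutation-minus-weights-orthonormal π-injective Out.W Out.W-gram)
      (RowsOrthonormal-cong (λ x u → cong₂ _-_ (P-transpose x u) (W-transpose x u)) W-transpose
        (permutation-minus-weights-orthonormal σ-injective In.W In.W-gram))

    zero-entry : ∀ {i j} → ¬ Arc A i j → U i j ≈ᶜ 0ᶜ
    zero-entry {i} {j} i↛j =
        ≗⇒≃ (λ _ → cong₂ _-_ (cong ⟦_⟧ (dec-false (π i ≟ᶠ j) πi≢j)) (Out.W-zero i↛j))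
      , ≗⇒≃ (λ _ → Out.W-zero i↛j)
      where
      πi≢j : π i ≢ j
      πi≢j πi≡j = i↛j (subst (Arc A i) πi≡j (π-arc i))

    digraph-of : IsDigraphOf A U
    digraph-of i j =
        (λ i→j (_ , im≃0) → const-≄ (Out.W-nonzero i→j) im≃0)
      , (λ Uij≉0 → decidable-stable (A i j ≟ᵇ true) (Uij≉0 ∘ zero-entry))

  unitary-with-digraph : ∃[ U ] (IsUnitary U × IsDigraphOf A U)
  unitary-with-digraph = U , unitary , digraph-of

theorem11 : ∀ (n : ℕ) (A : Digraph n) →
    NoSources A → NoSinks A → NoIsolatedLoopless A →
    Specular A → StronglyQuadrangular A →
    ∃[ U ] (IsUnitary U × IsDigraphOf A U)
theorem11 n A _ no-sinks _ specular quadrangular =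
  unitary-with-digraph specular quadrangular no-sinks
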